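{- For every $\alpha>0$ and $k\in\mathbb{N}$ there exists $\gamma_0>0$ such that for every $0<\gamma\le\gamma_0$ there exists $n_0$ such that for all $n\ge n_0$ the following holds. Let $G^0$ be a $d$-regular digraph on $n$ vertices with $d\ge\alpha n$ and $\mathcal{P}=\{V_{ij}:i,j\in[k]\}$ a partition of $V(G^0)$ such that for all distinct $i,j\in[k]$: (i) $\delta(G^0[V_{i*},V_{*i}])\ge d/k$; (ii) $\sum_{i',j'\in[k],\,i'\ne j'}|V_{i'j'}|\le\gamma n$; (iii) for all $v\in V_{ij}$, $d^+(v,V_{*i})-d^-(v,V_{i*})\le\gamma n$. Then there exists a partition $\mathcal{P}'=\{V'_{ii}:i\in[k]\}$ of $V(G^0)$ such that for all $i\in[k]$: $|V_{ii}\triangle V'_{ii}|\le\gamma n$ and $\delta^0(G^0[V'_{ii}])\ge d/k-\gamma n$.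
   Context: $V_{i*}=\bigcup_jV_{ij}$, $V_{*i}=\bigcup_jV_{ji}$; $d^{\pm}(v,S)$ = number of out/inneighbours of $v$ in $S$. $G^0[U,W]$ is the undirected bipartite graph with vertex classes a copy of $U$ and a copy of $W$ (vertices in $U\cap W$ appear twice), $u\sim w$ iff $uw\in E(G^0)$; $\delta$ is minimum degree. $G^0[V'_{ii}]$ is the induced subdigraph and $\delta^0$ denotes minimum semi-degree (minimum over vertices of the smaller of in- and outdegree).
   Formalization: The constants α and γ range over the positive rationals. -}

module Defs where

open import Data.Nat using (ℕ; zero; suc; _+_)
open import Data.Integer using (+_)
open import Data.Rational using (ℚ; _/_; 0ℚ)
open import Data.Bool using (Bool; true; false; _∧_; _xor_; not; if_then_else_)
open import Data.Fin using (Fin; _≟_)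
open import Data.Product using (_×_; proj₁; proj₂)
open import Relation.Nullary.Decidable using (⌊_⌋)
open import Relation.Binary.PropositionalEquality using (_≡_)

ℕtoℚ : ℕ → ℚ
ℕtoℚ n = + n / 1

-- d / k as a rational; k = 0 is given the dummy value 0 (never used: every
-- occurrence is under a quantifier over Fin k, so k ≥ 1 there)
_÷_ : ℕ → ℕ → ℚ
d ÷ zero = 0ℚ
d ÷ suc k = + d / suc k

VSet : ℕ → Set
VSet n = Fin n → Bool

∣_∣ : ∀ {n} → VSet n → ℕ
∣_∣ {zero} S = 0
∣_∣ {suc n} S = (if S Fin.zero then 1 else 0) + ∣ (λ v → S (Fin.suc v)) ∣

sumFin : (k : ℕ) → (Fin k → ℕ) → ℕ
sumFin zero f = 0
sumFin (suc k) f = f Fin.zero + sumFin k (λ i → f (Fin.suc i))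

-- a digraph on vertex set Fin n: adjacency E u v = true iff uv is an edge
Digraph : ℕ → Set
Digraph n = Fin n → Fin n → Bool

Loopless : ∀ {n} → Digraph n → Set
Loopless {n} E = (v : Fin n) → E v v ≡ false

outdeg : ∀ {n} → Digraph n → Fin n → VSet n → ℕ
outdeg E v S = ∣ (λ w → E v w ∧ S w) ∣

indeg : ∀ {n} → Digraph n → Fin n → VSet n → ℕ
indeg E v S = ∣ (λ w → E w v ∧ S w) ∣

all : ∀ {n} → VSet n
all _ = true

Regular : ∀ {n} → Digraph n → ℕ → Set
Regular {n} E d = (v : Fin n) → (outdeg E v all ≡ d) × (indeg E v all ≡ d)

-- a partition {V_ij : i,j ∈ [k]} of Fin n, given by the index of the part of each vertex
Partition2 : ℕ → ℕ → Set
Partition2 n k = Fin n → Fin k × Fin k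

module _ {n k : ℕ} (P : Partition2 n k) where
  V : Fin k → Fin k → VSet n
  V i j v = ⌊ proj₁ (P v) ≟ i ⌋ ∧ ⌊ proj₂ (P v) ≟ j ⌋

  -- V_{i*} = ⋃_j V_ij
  V_*  : Fin k → VSet n
  V_* i v = ⌊ proj₁ (P v) ≟ i ⌋

  -- V_{*i} = ⋃_j V_ji
  V*_ : Fin k → VSet n
  V*_ i v = ⌊ proj₂ (P v) ≟ i ⌋

  offDiagSize : ℕ
  offDiagSize = sumFin k (λ i' → sumFin k (λ j' →
                  if ⌊ i' ≟ j' ⌋ then 0 else ∣ V i' j' ∣))

Partition1 : ℕ → ℕ → Set
Partition1 n k = Fin n → Fin k

V′ : ∀ {n k} → Partition1 n k → Fin k → VSet n
V′ Q i v = ⌊ Q v ≟ i ⌋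

_△_ : ∀ {n} → VSet n → VSet n → VSet n
(A △ B) v = A v xor B v

-- δ(G[U,W]) ≥ x, for the bipartite graph G[U,W] (classes: a copy of U and a copy
-- of W, u ∼ w iff uw ∈ E(G)): every vertex of either class has degree ≥ x.
-- The degree of a copy of u ∈ U is d⁺(u,W), of a copy of w ∈ W is d⁻(w,U).
BipMinDeg≥ : ∀ {n} → Digraph n → VSet n → VSet n → ℚ → Set
BipMinDeg≥ {n} E U W x =
  ((u : Fin n) → U u ≡ true → x Data.Rational.≤ ℕtoℚ (outdeg E u W)) ×
  ((w : Fin n) → W w ≡ true → x Data.Rational.≤ ℕtoℚ (indeg E w U))

SemiDeg≥ : ∀ {n} → Digraph n → VSet n → ℚ → Set
SemiDeg≥ {n} E S x =
  (v : Fin n) → S v ≡ true →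
  (x Data.Rational.≤ ℕtoℚ (outdeg E v S)) × (x Data.Rational.≤ ℕtoℚ (indeg E v S))

-- Take V′ᵢᵢ = V_{i*}, i.e. put each vertex into the part of its first index.
-- Every vertex of Vᵢᵢ △ V_{i*} and of V_{*i} ∖ V_{i*} lies in an off-diagonal
-- part, so both sets have at most γn elements by (ii). Hence a vertex v ∈ V_{i*},
-- which has at least d/k outneighbours in V_{*i} by (i), keeps at least
-- d/k − γn of them in V_{i*}. For inneighbours: if v ∈ Vᵢᵢ then v ∈ V_{*i} and
-- (i) gives d/k of them in V_{i*}; otherwise v ∈ Vᵢⱼ with j ≠ i and (iii)
-- converts the d/k outneighbours into d/k − γn inneighbours. For k = 1 the
-- hypotheses are vacuous, but then V_{1*} is everything and regularity
-- suffices. So γ₀ = 1 and n₀ = 0 work, independently of α.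
module Submission where

open import Defs
open import Data.Nat using (ℕ) renaming (_≥_ to _≥ℕ_)
open import Data.Rational using (ℚ; 0ℚ; _<_; _≤_; _*_; _-_)
open import Data.Fin using (Fin)
open import Data.Bool using (true)
open import Data.Product using (Σ; _×_; _,_)
open import Relation.Binary.PropositionalEquality using (_≡_; _≢_)

open import Data.Nat as ℕ using (zero; suc; z≤n; s≤s)
import Data.Nat.Properties as ℕ
open import Data.Nat.Coprimality using (1-coprimeTo) renaming (sym to coprime-sym)
open import Data.Integer as ℤ using (+_)
import Data.Integer.Properties as ℤ
open import Data.Rational using (mkℚ; 1ℚ; nonNegative; _+_; -_; toℚᵘ; *≤*)
open import Data.Rational.Properties
  using (≤-trans; ≤-reflexive; +-monoˡ-≤; +-monoʳ-≤; +-identityʳ; module ≤-Reasoning;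
         normalize-coprime; toℚᵘ-injective; toℚᵘ-homo-+;
         nonNegative⁻¹; nonNeg*nonNeg⇒nonNeg; normalize-nonNeg; positive⁻¹; <⇒≤)
import Data.Rational.Unnormalised as ℚᵘ
import Data.Rational.Unnormalised.Properties as ℚᵘ
open import Data.Rational.Solver using (module +-*-Solver)
open import Data.Bool using (Bool; false; _∧_; _∨_; not; if_then_else_)
open import Data.Fin using (_≟_)
open import Data.Product using (proj₁; proj₂)
open import Relation.Nullary using (Dec; ¬_; yes; no)
open import Relation.Nullary.Decidable using (⌊_⌋; isYes≗does; dec-true; dec-false)
open import Relation.Binary.PropositionalEquality using (refl; sym; trans; cong; cong₂)
open import Algebra.Properties.CommutativeSemigroup ℕ.+-commutativeSemigroup using (interchange)
open import Algebra.Properties.CommutativeMonoid.Sum ℕ.+-0-commutativeMonoid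
  using (sum; ∑-comm; sum-cong-≗; sum-replicate-zero)

ℕtoℚ≡mkℚ : ∀ n → ℕtoℚ n ≡ mkℚ (+ n) 0 (coprime-sym (1-coprimeTo n))
ℕtoℚ≡mkℚ n = normalize-coprime (coprime-sym (1-coprimeTo n))

ℕtoℚ-mono-≤ : ∀ {m n} → m ℕ.≤ n → ℕtoℚ m ≤ ℕtoℚ n
ℕtoℚ-mono-≤ {m} {n} m≤n rewrite ℕtoℚ≡mkℚ m | ℕtoℚ≡mkℚ n =
  *≤* (ℤ.*-monoʳ-≤-nonNeg (+ 1) (ℤ.+≤+ m≤n))

ℕtoℚ-homo-+ : ∀ m n → ℕtoℚ (m ℕ.+ n) ≡ ℕtoℚ m + ℕtoℚ n
ℕtoℚ-homo-+ m n = toℚᵘ-injective (ℚᵘ.≃-trans integral (ℚᵘ.≃-sym (toℚᵘ-homo-+ (ℕtoℚ m) (ℕtoℚ n))))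
  where
  integral : toℚᵘ (ℕtoℚ (m ℕ.+ n)) ℚᵘ.≃ toℚᵘ (ℕtoℚ m) ℚᵘ.+ toℚᵘ (ℕtoℚ n)
  integral rewrite ℕtoℚ≡mkℚ (m ℕ.+ n) | ℕtoℚ≡mkℚ m | ℕtoℚ≡mkℚ n =
    ℚᵘ.*≡* (cong (ℤ._* + 1) (sym (cong₂ ℤ._+_ (ℤ.*-identityʳ (+ m)) (ℤ.*-identityʳ (+ n)))))

open +-*-Solver using (solve; _:+_; _:-_; _:=_)

p≤q+r⇒p-r≤q : ∀ {p q r} → p ≤ q + r → p - r ≤ q
p≤q+r⇒p-r≤q {p} {q} {r} p≤q+r = ≤-trans (+-monoˡ-≤ (- r) p≤q+r)
  (≤-reflexive (solve 2 (λ q r → q :+ r :- r := q) refl q r))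

p-q≤p : ∀ {p q} → 0ℚ ≤ q → p - q ≤ p
p-q≤p {p} 0≤q = p≤q+r⇒p-r≤q (≤-trans (≤-reflexive (sym (+-identityʳ p))) (+-monoʳ-≤ p 0≤q))

p≤q⇒q-r≤s⇒p-s≤r : ∀ {p q r s} → p ≤ q → q - r ≤ s → p - s ≤ r
p≤q⇒q-r≤s⇒p-s≤r {p} {q} {r} {s} p≤q q-r≤s = p≤q+r⇒p-r≤q (begin
  p             ≤⟨ p≤q ⟩
  q             ≡⟨ solve 2 (λ q r → q := r :+ (q :- r)) refl q r ⟩
  r + (q - r)   ≤⟨ +-monoʳ-≤ r q-r≤s ⟩
  r + s         ∎)
  where open ≤-Reasoning

infix 4 _⊆_
infixr 6 _∪_ _∖_

_⊆_ : ∀ {n} → VSet n → VSet n → Set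
S ⊆ T = ∀ v → S v ≡ true → T v ≡ true

_∪_ : ∀ {n} → VSet n → VSet n → VSet n
(S ∪ T) v = S v ∨ T v

_∖_ : ∀ {n} → VSet n → VSet n → VSet n
(S ∖ T) v = S v ∧ not (T v)

𝟙 : Bool → ℕ
𝟙 b = if b then 1 else 0

∣∣≡sum : ∀ {n} (S : VSet n) → ∣ S ∣ ≡ sum (λ v → 𝟙 (S v))
∣∣≡sum {zero} S = refl
∣∣≡sum {suc n} S = cong (𝟙 (S Fin.zero) ℕ.+_) (∣∣≡sum (λ v → S (Fin.suc v)))

∣∣-mono-⊆ : ∀ {n} {S T : VSet n} → S ⊆ T → ∣ S ∣ ℕ.≤ ∣ T ∣
∣∣-mono-⊆ {zero} S⊆T = z≤n
∣∣-mono-⊆ {suc n} {S} {T} S⊆T =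
  ℕ.+-mono-≤ (𝟙-mono (S⊆T Fin.zero)) (∣∣-mono-⊆ (λ v → S⊆T (Fin.suc v)))
  where
  𝟙-mono : ∀ {a b} → (a ≡ true → b ≡ true) → 𝟙 a ℕ.≤ 𝟙 b
  𝟙-mono {false} _ = z≤n
  𝟙-mono {true} a⇒b rewrite a⇒b refl = s≤s z≤n

∣∪∣≤∣∣+∣∣ : ∀ {n} (S T : VSet n) → ∣ S ∪ T ∣ ℕ.≤ ∣ S ∣ ℕ.+ ∣ T ∣
∣∪∣≤∣∣+∣∣ {zero} S T = z≤n
∣∪∣≤∣∣+∣∣ {suc n} S T = begin
  𝟙 (s ∨ t) ℕ.+ ∣ tail (S ∪ T) ∣          ≤⟨ ℕ.+-mono-≤ (𝟙-∨ s t) (∣∪∣≤∣∣+∣∣ (tail S) (tail T)) ⟩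
  (𝟙 s ℕ.+ 𝟙 t) ℕ.+ (∣ tail S ∣ ℕ.+ ∣ tail T ∣) ≡⟨ interchange (𝟙 s) (𝟙 t) ∣ tail S ∣ ∣ tail T ∣ ⟩
  ∣ S ∣ ℕ.+ ∣ T ∣                               ∎
  where
  open ℕ.≤-Reasoning
  s = S Fin.zero
  t = T Fin.zero
  tail : VSet (suc n) → VSet n
  tail U v = U (Fin.suc v)
  𝟙-∨ : ∀ a b → 𝟙 (a ∨ b) ℕ.≤ 𝟙 a ℕ.+ 𝟙 b
  𝟙-∨ false b = ℕ.≤-refl
  𝟙-∨ true b = s≤s z≤n

∣∣-⊆-∪ : ∀ {n} {S T U : VSet n} → S ⊆ T ∪ U → ∣ S ∣ ℕ.≤ ∣ T ∣ ℕ.+ ∣ U ∣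
∣∣-⊆-∪ {T = T} {U} S⊆T∪U = ℕ.≤-trans (∣∣-mono-⊆ S⊆T∪U) (∣∪∣≤∣∣+∣∣ T U)

sumFin≡sum : ∀ k (f : Fin k → ℕ) → sumFin k f ≡ sum f
sumFin≡sum zero f = refl
sumFin≡sum (suc k) f = cong (f Fin.zero ℕ.+_) (sumFin≡sum k (λ i → f (Fin.suc i)))

sum-mono-≤ : ∀ {k} {f g : Fin k → ℕ} → (∀ i → f i ℕ.≤ g i) → sum f ℕ.≤ sum g
sum-mono-≤ {zero} f≤g = z≤n
sum-mono-≤ {suc k} f≤g = ℕ.+-mono-≤ (f≤g Fin.zero) (sum-mono-≤ (λ i → f≤g (Fin.suc i)))

≤-sum : ∀ {k} (f : Fin k → ℕ) i → f i ℕ.≤ sum f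
≤-sum f Fin.zero = ℕ.m≤m+n (f Fin.zero) _
≤-sum f (Fin.suc i) = ℕ.≤-trans (≤-sum (λ j → f (Fin.suc j)) i) (ℕ.m≤n+m _ (f Fin.zero))

∧-monoʳ-true : ∀ a {b c} → (b ≡ true → c ≡ true) → a ∧ b ≡ true → a ∧ c ≡ true
∧-monoʳ-true true b⇒c = b⇒c

outdeg-mono-⊆ : ∀ {n} (E : Digraph n) v {S T : VSet n} → S ⊆ T → outdeg E v S ℕ.≤ outdeg E v T
outdeg-mono-⊆ E v S⊆T = ∣∣-mono-⊆ λ w → ∧-monoʳ-true (E v w) (S⊆T w)

indeg-mono-⊆ : ∀ {n} (E : Digraph n) v {S T : VSet n} → S ⊆ T → indeg E v S ℕ.≤ indeg E v T
indeg-mono-⊆ E v S⊆T = ∣∣-mono-⊆ λ w → ∧-monoʳ-true (E w v) (S⊆T w)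

outdeg≤outdeg+∣∖∣ : ∀ {n} (E : Digraph n) v (S T : VSet n) →
                   outdeg E v T ℕ.≤ outdeg E v S ℕ.+ ∣ T ∖ S ∣
outdeg≤outdeg+∣∖∣ E v S T = ∣∣-⊆-∪ λ w → split (E v w) (T w) (S w)
  where
  split : ∀ e t s → e ∧ t ≡ true → (e ∧ s) ∨ (t ∧ not s) ≡ true
  split true true true _ = refl
  split true true false _ = refl

⌊⌋-true : ∀ {a} {A : Set a} (a? : Dec A) → A → ⌊ a? ⌋ ≡ true
⌊⌋-true a? a = trans (isYes≗does a?) (dec-true a? a)

⌊⌋-false : ∀ {a} {A : Set a} (a? : Dec A) → ¬ A → ⌊ a? ⌋ ≡ false
⌊⌋-false a? ¬a = trans (isYes≗does a?) (dec-false a? ¬a)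

module _ {n k : ℕ} (P : Partition2 n k) where
  OffDiagonal : Fin n → Set
  OffDiagonal v = proj₁ (P v) ≢ proj₂ (P v)

  ∣∣≤offDiagSize : {T : VSet n} → (∀ v → T v ≡ true → OffDiagonal v) → ∣ T ∣ ℕ.≤ offDiagSize P
  ∣∣≤offDiagSize {T} T⊆offDiag = begin
    ∣ T ∣                                       ≡⟨ ∣∣≡sum T ⟩
    sum (λ v → 𝟙 (T v))                         ≤⟨ sum-mono-≤ 𝟙≤entries ⟩
    sum (λ v → sum (λ i → sum (λ j → entry i j v))) ≡⟨ ∑-comm (λ i v → sum (λ j → entry i j v)) ⟨
    sum (λ i → sum (λ v → sum (λ j → entry i j v))) ≡⟨ sum-cong-≗ (λ i → ∑-comm (λ j v → entry i j v)) ⟨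
    sum (λ i → sum (λ j → sum (entry i j)))      ≡⟨ sum-cong-≗ (λ i → sum-cong-≗ (λ j → blockSize i j)) ⟨
    sum (λ i → sum (block i))                   ≡⟨ offDiagSize≡sum ⟨
    offDiagSize P                               ∎
    where
    open ℕ.≤-Reasoning
    block : Fin k → Fin k → ℕ
    block i j = if ⌊ i ≟ j ⌋ then 0 else ∣ V P i j ∣
    offDiagSize≡sum : offDiagSize P ≡ sum (λ i → sum (block i))
    offDiagSize≡sum = trans (sumFin≡sum k (λ i → sumFin k (block i))) (sum-cong-≗ (λ i → sumFin≡sum k (block i)))
    entry : Fin k → Fin k → Fin n → ℕ
    entry i j v = if ⌊ i ≟ j ⌋ then 0 else 𝟙 (V P i j v)
    blockSize : ∀ i j → block i j ≡ sum (entry i j)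
    blockSize i j with ⌊ i ≟ j ⌋
    ... | true = sym (sum-replicate-zero n)
    ... | false = ∣∣≡sum (V P i j)
    entry-offDiagonal : ∀ v → OffDiagonal v → entry (proj₁ (P v)) (proj₂ (P v)) v ≡ 1
    entry-offDiagonal v a≢b
      rewrite ⌊⌋-false (proj₁ (P v) ≟ proj₂ (P v)) a≢b
            | ⌊⌋-true (proj₁ (P v) ≟ proj₁ (P v)) refl
            | ⌊⌋-true (proj₂ (P v) ≟ proj₂ (P v)) refl = refl
    𝟙≤entries : ∀ v → 𝟙 (T v) ℕ.≤ sum (λ i → sum (λ j → entry i j v))
    𝟙≤entries v with T v in Tv
    ... | false = z≤n
    ... | true = begin
      1                                                ≡⟨ entry-offDiagonal v (T⊆offDiag v Tv) ⟨
      entry (proj₁ (P v)) (proj₂ (P v)) v              ≤⟨ ≤-sum (λ j → entry (proj₁ (P v)) j v) (proj₂ (P v)) ⟩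
      sum (λ j → entry (proj₁ (P v)) j v)              ≤⟨ ≤-sum (λ i → sum (λ j → entry i j v)) (proj₁ (P v)) ⟩
      sum (λ i → sum (λ j → entry i j v))              ∎

module _ {n k : ℕ} (P : Partition2 n k) (i : Fin k) where
  Vᵢᵢ△Vᵢ*-offDiagonal : ∀ v → (V P i i △ V_* P i) v ≡ true → OffDiagonal P v
  Vᵢᵢ△Vᵢ*-offDiagonal v e with proj₁ (P v) ≟ i | proj₂ (P v) ≟ i
  Vᵢᵢ△Vᵢ*-offDiagonal v () | yes _ | yes _
  Vᵢᵢ△Vᵢ*-offDiagonal v e  | yes a≡i | no b≢i = λ a≡b → b≢i (trans (sym a≡b) a≡i)
  Vᵢᵢ△Vᵢ*-offDiagonal v () | no _ | _

  V*ᵢ∖Vᵢ*-offDiagonal : ∀ v → (V*_ P i ∖ V_* P i) v ≡ true → OffDiagonal P v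
  V*ᵢ∖Vᵢ*-offDiagonal v e with proj₁ (P v) ≟ i | proj₂ (P v) ≟ i
  V*ᵢ∖Vᵢ*-offDiagonal v e  | no a≢i | yes b≡i = λ a≡b → a≢i (trans a≡b b≡i)
  V*ᵢ∖Vᵢ*-offDiagonal v () | yes _ | yes _
  V*ᵢ∖Vᵢ*-offDiagonal v () | _ | no _

  module _ {γn : ℚ} (offDiag≤γn : ℕtoℚ (offDiagSize P) ≤ γn) where
    ∣Vᵢᵢ△Vᵢ*∣≤ : ℕtoℚ ∣ V P i i △ V_* P i ∣ ≤ γn
    ∣Vᵢᵢ△Vᵢ*∣≤ = ≤-trans (ℕtoℚ-mono-≤ (∣∣≤offDiagSize P Vᵢᵢ△Vᵢ*-offDiagonal)) offDiag≤γn

    outdeg-Vᵢ* : ∀ (E : Digraph n) v {x} → x ≤ ℕtoℚ (outdeg E v (V*_ P i)) →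
                 x - γn ≤ ℕtoℚ (outdeg E v (V_* P i))
    outdeg-Vᵢ* E v {x} x≤out = p≤q+r⇒p-r≤q (begin
      x                                           ≤⟨ x≤out ⟩
      ℕtoℚ (outdeg E v (V*_ P i))                 ≤⟨ ℕtoℚ-mono-≤ out≤out+offDiag ⟩
      ℕtoℚ (outdeg E v (V_* P i) ℕ.+ offDiagSize P) ≡⟨ ℕtoℚ-homo-+ (outdeg E v (V_* P i)) (offDiagSize P) ⟩
      ℕtoℚ (outdeg E v (V_* P i)) + ℕtoℚ (offDiagSize P) ≤⟨ +-monoʳ-≤ (ℕtoℚ (outdeg E v (V_* P i))) offDiag≤γn ⟩
      ℕtoℚ (outdeg E v (V_* P i)) + γn            ∎)
      where
      open ≤-Reasoning
      out≤out+offDiag : outdeg E v (V*_ P i) ℕ.≤ outdeg E v (V_* P i) ℕ.+ offDiagSize P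
      out≤out+offDiag = ℕ.≤-trans (outdeg≤outdeg+∣∖∣ E v (V_* P i) (V*_ P i))
        (ℕ.+-monoʳ-≤ _ (∣∣≤offDiagSize P V*ᵢ∖Vᵢ*-offDiagonal))

  indeg-Vᵢ* : ∀ (E : Digraph n) v {x γn} → 0ℚ ≤ γn →
              (∀ w → V*_ P i w ≡ true → x ≤ ℕtoℚ (indeg E w (V_* P i))) →
              V_* P i v ≡ true → x ≤ ℕtoℚ (outdeg E v (V*_ P i)) →
              (∀ j → i ≢ j → V P i j v ≡ true →
                 ℕtoℚ (outdeg E v (V*_ P i)) - ℕtoℚ (indeg E v (V_* P i)) ≤ γn) →
              x - γn ≤ ℕtoℚ (indeg E v (V_* P i))
  indeg-Vᵢ* E v 0≤γn x≤in v∈Vᵢ* x≤out out-in≤γn with proj₂ (P v) ≟ i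
  ... | yes b≡i = ≤-trans (p-q≤p 0≤γn) (x≤in v (⌊⌋-true (proj₂ (P v) ≟ i) b≡i))
  ... | no b≢i = p≤q⇒q-r≤s⇒p-s≤r x≤out (out-in≤γn (proj₂ (P v)) (λ i≡b → b≢i (sym i≡b)) v∈Vᵢⱼ)
    where
    v∈Vᵢⱼ : V P i (proj₂ (P v)) v ≡ true
    v∈Vᵢⱼ rewrite v∈Vᵢ* = ⌊⌋-true (proj₂ (P v) ≟ proj₂ (P v)) refl

all⊆V₁* : ∀ {n} (P : Partition2 n 1) → all ⊆ V_* P Fin.zero
all⊆V₁* P v _ with proj₁ (P v)
... | Fin.zero = refl

another : ∀ {k} → Fin (suc (suc k)) → Fin (suc (suc k))
another Fin.zero = Fin.suc Fin.zero
another (Fin.suc _) = Fin.zero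

another-≢ : ∀ {k} (i : Fin (suc (suc k))) → i ≢ another i
another-≢ Fin.zero ()
another-≢ (Fin.suc _) ()

Hypotheses : ∀ {n} k → Digraph n → ℕ → Partition2 n k → ℚ → Set
Hypotheses {n} k E d P γn = (i j : Fin k) → i ≢ j →
  BipMinDeg≥ E (V_* P i) (V*_ P i) (d ÷ k) ×
  ℕtoℚ (offDiagSize P) ≤ γn ×
  ((v : Fin n) → V P i j v ≡ true →
    ℕtoℚ (outdeg E v (V*_ P i)) - ℕtoℚ (indeg E v (V_* P i)) ≤ γn)

rowPartition-sound : ∀ {n} k (E : Digraph n) d (P : Partition2 n k) {γn} → 0ℚ ≤ γn →
                     Regular E d → Hypotheses k E d P γn → (i : Fin k) →
                     (ℕtoℚ ∣ V P i i △ V_* P i ∣ ≤ γn) × SemiDeg≥ E (V_* P i) ((d ÷ k) - γn)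
-- For k = 1, offDiagSize P reduces to 0, so 0 ≤ γn already bounds it.
rowPartition-sound 1 E d P {γn} 0≤γn regular _ Fin.zero = ∣Vᵢᵢ△Vᵢ*∣≤ P Fin.zero 0≤γn , semiDeg
  where
  semiDeg : SemiDeg≥ E (V_* P Fin.zero) (ℕtoℚ d - γn)
  semiDeg v _ = d-γn≤ (ℕ.≤-trans (ℕ.≤-reflexive (sym (proj₁ (regular v)))) (outdeg-mono-⊆ E v (all⊆V₁* P))) ,
                d-γn≤ (ℕ.≤-trans (ℕ.≤-reflexive (sym (proj₂ (regular v)))) (indeg-mono-⊆ E v (all⊆V₁* P)))
    where
    d-γn≤ : ∀ {m} → d ℕ.≤ m → ℕtoℚ d - γn ≤ ℕtoℚ m
    d-γn≤ d≤m = ≤-trans (p-q≤p 0≤γn) (ℕtoℚ-mono-≤ d≤m)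
rowPartition-sound (suc (suc k)) E d P {γn} 0≤γn _ hyp i = ∣Vᵢᵢ△Vᵢ*∣≤ P i offDiag≤γn , semiDeg
  where
  bip = proj₁ (hyp i (another i) (another-≢ i))
  offDiag≤γn = proj₁ (proj₂ (hyp i (another i) (another-≢ i)))
  semiDeg : SemiDeg≥ E (V_* P i) ((d ÷ suc (suc k)) - γn)
  semiDeg v v∈Vᵢ* = outdeg-Vᵢ* P i offDiag≤γn E v (proj₁ bip v v∈Vᵢ*) ,
    indeg-Vᵢ* P i E v 0≤γn (proj₂ bip) v∈Vᵢ* (proj₁ bip v v∈Vᵢ*) (λ j i≢j → proj₂ (proj₂ (hyp i j i≢j)) v)

proposition6p2 : (α : ℚ) → 0ℚ < α → (k : ℕ) →
    Σ ℚ λ γ₀ → 0ℚ < γ₀ ×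
    ((γ : ℚ) → 0ℚ < γ → γ ≤ γ₀ →
    Σ ℕ λ n₀ → (n : ℕ) → n ≥ℕ n₀ →
    (E : Digraph n) → Loopless E → (d : ℕ) → Regular E d →
    α * ℕtoℚ n ≤ ℕtoℚ d →
    (P : Partition2 n k) →
    ((i j : Fin k) → i ≢ j →
    BipMinDeg≥ E (V_* P i) (V*_ P i) (d ÷ k) ×
    ℕtoℚ (offDiagSize P) ≤ γ * ℕtoℚ n ×
    ((v : Fin n) → V P i j v ≡ true →
    ℕtoℚ (outdeg E v (V*_ P i)) - ℕtoℚ (indeg E v (V_* P i)) ≤ γ * ℕtoℚ n)) →
    Σ (Partition1 n k) λ Q →
    (i : Fin k) →
    (ℕtoℚ ∣ V P i i △ V′ Q i ∣ ≤ γ * ℕtoℚ n) ×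
    SemiDeg≥ E (V′ Q i) ((d ÷ k) - γ * ℕtoℚ n))
proposition6p2 α _ k = 1ℚ , positive⁻¹ 1ℚ , λ γ 0<γ _ → 0 , λ n _ E _ d regular _ P hyp →
  (λ v → proj₁ (P v)) , rowPartition-sound k E d P (γn-nonNeg 0<γ n) regular hyp
  where
  γn-nonNeg : ∀ {γ} → 0ℚ < γ → ∀ n → 0ℚ ≤ γ * ℕtoℚ n
  γn-nonNeg {γ} 0<γ n = nonNegative⁻¹ (γ * ℕtoℚ n)
    {{nonNeg*nonNeg⇒nonNeg γ {{nonNegative (<⇒≤ 0<γ)}} (ℕtoℚ n) {{normalize-nonNeg n 1}}}}
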